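{- Let $q=2^k$ with $k\ge1$, let $n=4m$ with $m\ge1$, and let $t,s\in\mathrm{GF}(q)$. Then $F(n,t,s,0)=q^{2m-1}$ if $t=0$ and $F(n,t,s,0)=0$ if $t\neq0$.
   Context: For $\gamma\in\mathrm{GF}(q^n)$, $Tr(\gamma)=\sum_{i=0}^{n-1}\gamma^{q^i}$ and $St(\gamma)=\sum_{0\le i<j<n}\gamma^{q^i}\gamma^{q^j}$. For $\alpha\in\mathrm{GF}(q^{2m})$, $R_\alpha=\{\gamma\in\mathrm{GF}(q^n):\gamma^{q^{2m}}+\gamma=\alpha\}$ (so $R_0=\mathrm{GF}(q^{2m})$), and $F(n,t,s,\alpha)=|\{\gamma\in R_\alpha: Tr(\gamma)=t,\ St(\gamma)=s\}|$. -}

module Defs where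

open import Level using (0ℓ)
open import Data.Nat as ℕ using (ℕ; zero; suc)
open import Data.Fin as Fin using (Fin)
open import Data.Product as P using (∃; _×_)
open import Relation.Nullary using (¬_; Dec; yes; no)
open import Relation.Binary using (Decidable)
open import Relation.Binary.PropositionalEquality using (_≡_)
open import Algebra.Bundles using (CommutativeRing)

record FiniteField : Set₁ where
  field
    commRing : CommutativeRing 0ℓ 0ℓ
  open CommutativeRing commRing public
  field
    _≟_       : Decidable _≈_
    nontrivial : ¬ (1# ≈ 0#)
    inverse   : ∀ x → ¬ (x ≈ 0#) → ∃ λ y → (x * y) ≈ 1#
    size      : ℕ
    enum      : Fin size → Carrier
    enum-surj : ∀ x → ∃ λ i → enum i ≈ x
    enum-inj  : ∀ i j → enum i ≈ enum j → i ≡ j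


count : ∀ {N} {P : Fin N → Set} → ((i : Fin N) → Dec (P i)) → ℕ
count {zero} d = 0
count {suc N} d with d Fin.zero
... | yes _ = suc (count (λ i → d (Fin.suc i)))
... | no  _ = count (λ i → d (Fin.suc i))

module _ (K : FiniteField) where
  open FiniteField K

  pow : Carrier → ℕ → Carrier
  pow x zero    = 1#
  pow x (suc e) = x * pow x e

  Σ< : ℕ → (ℕ → Carrier) → Carrier
  Σ< zero    f = 0#
  Σ< (suc n) f = Σ< n f + f n

  Tr : (q n : ℕ) → Carrier → Carrier
  Tr q n γ = Σ< n (λ i → pow γ (q ℕ.^ i))

  St : (q n : ℕ) → Carrier → Carrier
  St q n γ = Σ< n (λ j → Σ< j (λ i → pow γ (q ℕ.^ i) * pow γ (q ℕ.^ j)))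

  InR : (q m : ℕ) → Carrier → Carrier → Set
  InR q m α γ = (pow γ (q ℕ.^ (2 ℕ.* m)) + γ) ≈ α

  Fcount : (q n m : ℕ) → (t s α : Carrier) → ℕ
  Fcount q n m t s α = count {size}
    {λ i → InR q m α (enum i) × (Tr q n (enum i) ≈ t × St q n (enum i) ≈ s)}
    (λ i → dec3 (enum i))
    where
    dec3 : ∀ γ → Dec (InR q m α γ × (Tr q n γ ≈ t × St q n γ ≈ s))
    dec3 γ with (pow γ (q ℕ.^ (2 ℕ.* m)) + γ) ≟ α | Tr q n γ ≟ t | St q n γ ≟ s
    ... | yes a | yes b | yes c = yes (a P., (b P., c))
    ... | no ¬a | _ | _ = no λ p → ¬a (P.proj₁ p)
    ... | yes _ | no ¬b | _ = no λ p → ¬b (P.proj₁ (P.proj₂ p))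
    ... | yes _ | yes _ | no ¬c = no λ p → ¬c (P.proj₂ (P.proj₂ p))

-- For γ ∈ R₀ = GF(q^{2m}) the conjugates γ^{q^i} repeat with period 2m, so in characteristic 2
-- the trace over 4m conjugates vanishes and St γ = T(γ)², where T(γ) = Σ_{i<2m} γ^{q^i} is the
-- relative trace onto GF(q). Squaring is injective, so F(4m, 0, s, 0) counts the single fibre
-- T⁻¹(√s) of the additive map T : R₀ → GF(q). Every nonempty fibre has the size κ of the kernel;
-- κ ≤ q^{2m-1} since T is a monic polynomial of that degree, |GF(q)| ≤ q likewise, and
-- |R₀| ≥ q^{2m} since x ↦ x^{q^{2m}} + x maps K, of size q^{4m}, into R₀ with kernel R₀.
-- So q^{2m} ≤ |R₀| ≤ κ q ≤ q^{2m}, which forces κ = q^{2m-1} and T to be onto GF(q).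
-- That K has characteristic 2 and satisfies x^{|K|} = x is itself derived from |K| = 2^{4km}.

module Submission where

open import Defs
open import Level using (0ℓ)
open import Data.Nat as ℕ using (ℕ; zero; suc; z≤n; s≤s)
import Data.Nat.Properties as ℕ
open import Data.Fin as Fin using (Fin; toℕ; fromℕ<)
import Data.Fin.Properties as Fin
open import Data.Product using (Σ; ∃; _×_; _,_; proj₁; proj₂)
open import Data.Sum using (_⊎_; inj₁; inj₂)
open import Data.List using (List; []; _∷_; length; replicate; _++_)
import Data.List.Properties
open import Data.Empty using (⊥; ⊥-elim)
open import Data.Unit using (⊤; tt)
open import Relation.Nullary using (¬_; Dec; yes; no)
open import Relation.Nullary.Decidable using (_×-dec_; ¬?)
open import Relation.Unary using (Pred; Decidable; _⊆_; _≐_; Empty; Universal; _∪_; _∩_)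
open import Relation.Unary.Properties using (∁?; _∩?_)
open import Relation.Binary.PropositionalEquality as ≡ using (_≡_; _≢_)
open import Function.Bundles using (Inverse; Equivalence; _⇔_; mk⇔)
open import Function.Definitions using (Congruent)
open import Relation.Binary.Definitions using (_Respects_)

private variable
  N M : ℕ

count-mono : {P Q : Pred (Fin N) 0ℓ} (P? : Decidable P) (Q? : Decidable Q) → P ⊆ Q → count P? ℕ.≤ count Q?
count-mono {N = zero} P? Q? P⊆Q = z≤n
count-mono {N = suc N} P? Q? P⊆Q with P? Fin.zero | Q? Fin.zero
... | yes p | no ¬q = ⊥-elim (¬q (P⊆Q p))
... | yes _ | yes _ = s≤s (count-mono (λ i → P? (Fin.suc i)) (λ i → Q? (Fin.suc i)) P⊆Q)
... | no _  | yes _ = ℕ.m≤n⇒m≤1+n (count-mono (λ i → P? (Fin.suc i)) (λ i → Q? (Fin.suc i)) P⊆Q)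
... | no _  | no _  = count-mono (λ i → P? (Fin.suc i)) (λ i → Q? (Fin.suc i)) P⊆Q

count-cong : {P Q : Pred (Fin N) 0ℓ} (P? : Decidable P) (Q? : Decidable Q) → P ≐ Q → count P? ≡ count Q?
count-cong P? Q? (P⊆Q , Q⊆P) = ℕ.≤-antisym (count-mono P? Q? P⊆Q) (count-mono Q? P? Q⊆P)

count-empty : {P : Pred (Fin N) 0ℓ} (P? : Decidable P) → Empty P → count P? ≡ 0
count-empty {N = zero} P? ∅ = ≡.refl
count-empty {N = suc N} P? ∅ with P? Fin.zero
... | yes p = ⊥-elim (∅ Fin.zero p)
... | no _  = count-empty (λ i → P? (Fin.suc i)) (λ i → ∅ (Fin.suc i))

count-universal : {P : Pred (Fin N) 0ℓ} (P? : Decidable P) → Universal P → count P? ≡ N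
count-universal {N = zero} P? all = ≡.refl
count-universal {N = suc N} P? all with P? Fin.zero
... | yes _ = ≡.cong suc (count-universal (λ i → P? (Fin.suc i)) (λ i → all (Fin.suc i)))
... | no ¬p = ⊥-elim (¬p (all Fin.zero))

count-+-count-∁ : {P : Pred (Fin N) 0ℓ} (P? : Decidable P) → count P? ℕ.+ count (∁? P?) ≡ N
count-+-count-∁ {N = zero} P? = ≡.refl
count-+-count-∁ {N = suc N} P? with P? Fin.zero
... | yes _ = ≡.cong suc (count-+-count-∁ (λ i → P? (Fin.suc i)))
... | no _  = ≡.trans (ℕ.+-suc _ _) (≡.cong suc (count-+-count-∁ (λ i → P? (Fin.suc i))))

count-∪ : {R P Q : Pred (Fin N) 0ℓ} (R? : Decidable R) (P? : Decidable P) (Q? : Decidable Q)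
        → R ⊆ P ∪ Q → count R? ℕ.≤ count P? ℕ.+ count Q?
count-∪ {N = zero} R? P? Q? R⊆P∪Q = z≤n
count-∪ {N = suc N} R? P? Q? R⊆P∪Q
  with R? Fin.zero | P? Fin.zero | Q? Fin.zero
     | count-∪ (λ i → R? (Fin.suc i)) (λ i → P? (Fin.suc i)) (λ i → Q? (Fin.suc i)) R⊆P∪Q
... | yes r | no ¬p | no ¬q | _ with R⊆P∪Q r
...   | inj₁ p = ⊥-elim (¬p p)
...   | inj₂ q = ⊥-elim (¬q q)
count-∪ R? P? Q? _ | yes _ | yes _ | yes _ | ih = s≤s (ℕ.≤-trans ih (ℕ.+-monoʳ-≤ _ (ℕ.n≤1+n _)))
count-∪ R? P? Q? _ | yes _ | yes _ | no _  | ih = s≤s ih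
count-∪ R? P? Q? _ | yes _ | no _  | yes _ | ih = ℕ.≤-trans (s≤s ih) (ℕ.≤-reflexive (≡.sym (ℕ.+-suc _ _)))
count-∪ R? P? Q? _ | no _  | yes _ | yes _ | ih = ℕ.m≤n⇒m≤1+n (ℕ.≤-trans ih (ℕ.+-monoʳ-≤ _ (ℕ.n≤1+n _)))
count-∪ R? P? Q? _ | no _  | yes _ | no _  | ih = ℕ.m≤n⇒m≤1+n ih
count-∪ R? P? Q? _ | no _  | no _  | yes _ | ih = ℕ.≤-trans ih (ℕ.+-monoʳ-≤ _ (ℕ.n≤1+n _))
count-∪ R? P? Q? _ | no _  | no _  | no _  | ih = ih

count-< : {P′ P : Pred (Fin N) 0ℓ} (P′? : Decidable P′) (P? : Decidable P) {i : Fin N}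
        → P′ ⊆ P → P i → ¬ P′ i → count P′? ℕ.< count P?
count-< {N = suc N} P′? P? {Fin.zero} P′⊆P p ¬p′ with P′? Fin.zero | P? Fin.zero
... | yes p′ | _     = ⊥-elim (¬p′ p′)
... | no _   | no ¬p = ⊥-elim (¬p p)
... | no _   | yes _ = s≤s (count-mono (λ i → P′? (Fin.suc i)) (λ i → P? (Fin.suc i)) P′⊆P)
count-< {N = suc N} P′? P? {Fin.suc i} P′⊆P p ¬p′ with P′? Fin.zero | P? Fin.zero
  | count-< (λ i → P′? (Fin.suc i)) (λ i → P? (Fin.suc i)) P′⊆P p ¬p′
... | yes p′ | no ¬p  | _  = ⊥-elim (¬p (P′⊆P p′))
... | yes _  | yes _  | ih = s≤s ih
... | no _   | yes _  | ih = ℕ.m≤n⇒m≤1+n ih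
... | no _   | no _   | ih = ih

count-inj : {P : Pred (Fin N) 0ℓ} {Q : Pred (Fin M) 0ℓ} (P? : Decidable P) (Q? : Decidable Q)
          (f : Fin N → Fin M) → (∀ {i} → P i → Q (f i))
          → (∀ {i j} → P i → P j → f i ≡ f j → i ≡ j) → count P? ℕ.≤ count Q?
count-inj {N = zero} P? Q? f P⇒Qf f-inj = z≤n
count-inj {N = suc N} {Q = Q} P? Q? f P⇒Qf f-inj with P? Fin.zero
... | no _   = count-inj (λ i → P? (Fin.suc i)) Q? (λ i → f (Fin.suc i)) P⇒Qf
                 (λ p q e → Fin.suc-injective (f-inj p q e))
... | yes p₀ = ℕ.≤-trans (s≤s rest) (count-< Q′? Q? proj₁ (P⇒Qf p₀) (λ q′ → proj₂ q′ ≡.refl))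
  where
  Q′ : Pred (Fin _) 0ℓ
  Q′ = Q ∩ (λ j → j ≢ f Fin.zero)
  Q′? : Decidable Q′
  Q′? = Q? ∩? (λ j → ¬? (j Fin.≟ f Fin.zero))
  rest = count-inj (λ i → P? (Fin.suc i)) Q′? (λ i → f (Fin.suc i))
           (λ p → P⇒Qf p , λ e → Fin.0≢1+n (≡.sym (f-inj p p₀ e)))
           (λ p q e → Fin.suc-injective (f-inj p q e))

count-≤1 : {P : Pred (Fin N) 0ℓ} (P? : Decidable P) → (∀ {i j} → P i → P j → i ≡ j) → count P? ℕ.≤ 1
count-≤1 P? unique = count-inj P? (λ (_ : Fin 1) → yes tt) (λ _ → Fin.zero) (λ _ → tt) (λ p q _ → unique p q)

count-pos : {P : Pred (Fin N) 0ℓ} (P? : Decidable P) {i : Fin N} → P i → 1 ℕ.≤ count P?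
count-pos P? p = ℕ.≤-trans (s≤s z≤n) (count-< {P′ = λ _ → ⊥} (λ _ → no λ ()) P? (λ ()) p (λ ()))

module _ {P : Pred (Fin N) 0ℓ} {B : Pred (Fin M) 0ℓ} (P? : Decidable P) (B? : Decidable B)
         (g : Fin N → Fin M) (P⇒Bg : ∀ {i} → P i → B (g i)) where

  private
    P< : ℕ → Pred (Fin N) 0ℓ
    P< k = P ∩ (λ i → toℕ (g i) ℕ.< k)
    P<? : ∀ k → Decidable (P< k)
    P<? k = P? ∩? (λ i → toℕ (g i) ℕ.<? k)
    B< : ℕ → Pred (Fin M) 0ℓ
    B< k = B ∩ (λ j → toℕ j ℕ.< k)
    B<? : ∀ k → Decidable (B< k)
    B<? k = B? ∩? (λ j → toℕ j ℕ.<? k)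
    fibre? : ∀ j → Decidable (P ∩ (λ i → g i ≡ j))
    fibre? j = P? ∩? (λ i → g i Fin.≟ j)

    count-P<-suc : ∀ {k} (k<M : k ℕ.< M) → count (P<? (suc k)) ℕ.≤ count (P<? k) ℕ.+ count (fibre? (fromℕ< k<M))
    count-P<-suc k<M = count-∪ (P<? _) (P<? _) (fibre? _) λ (p , gi<1+k) →
      Data.Sum.map (p ,_) (λ gi≡k → p , Fin.toℕ-injective (≡.trans gi≡k (≡.sym (Fin.toℕ-fromℕ< k<M))))
                   (ℕ.m≤n⇒m<n∨m≡n (ℕ.s≤s⁻¹ gi<1+k))

    B<-mono : ∀ {k} → B< k ⊆ B< (suc k)
    B<-mono (b , j<k) = b , ℕ.m≤n⇒m≤1+n j<k

    module _ (c : ℕ) (fibre≤c : ∀ {j} → B j → count (fibre? j) ℕ.≤ c) where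
      count-P<≤c*count-B< : ∀ k → k ℕ.≤ M → count (P<? k) ℕ.≤ c ℕ.* count (B<? k)
      count-P<≤c*count-B< zero _ = ℕ.≤-trans (ℕ.≤-reflexive (count-empty (P<? zero) (λ _ p → ℕ.n≮0 (proj₂ p)))) z≤n
      count-P<≤c*count-B< (suc k) k<M with B? (fromℕ< k<M)
      ... | yes b = begin
        count (P<? (suc k))                        ≤⟨ count-P<-suc k<M ⟩
        count (P<? k) ℕ.+ count (fibre? j)         ≤⟨ ℕ.+-mono-≤ (count-P<≤c*count-B< k (ℕ.<⇒≤ k<M)) (fibre≤c b) ⟩
        c ℕ.* count (B<? k) ℕ.+ c                  ≡⟨ ≡.trans (ℕ.+-comm _ c) (≡.sym (ℕ.*-suc c _)) ⟩
        c ℕ.* suc (count (B<? k))                  ≤⟨ ℕ.*-monoʳ-≤ c (count-< (B<? k) (B<? (suc k)) B<-mono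
                                                        (b , ℕ.≤-reflexive (≡.cong suc toℕ-j))
                                                        (λ j<k → ℕ.<-irrefl toℕ-j (proj₂ j<k))) ⟩
        c ℕ.* count (B<? (suc k))                  ∎
        where
        open ℕ.≤-Reasoning
        j = fromℕ< k<M
        toℕ-j = Fin.toℕ-fromℕ< k<M
      ... | no ¬b = begin
        count (P<? (suc k))                        ≤⟨ count-P<-suc k<M ⟩
        count (P<? k) ℕ.+ count (fibre? j)         ≡⟨ ≡.cong (count (P<? k) ℕ.+_) (count-empty (fibre? j)
                                                        (λ i (p , gi≡j) → ¬b (≡.subst B gi≡j (P⇒Bg p)))) ⟩
        count (P<? k) ℕ.+ 0                        ≡⟨ ℕ.+-identityʳ _ ⟩
        count (P<? k)                              ≤⟨ count-P<≤c*count-B< k (ℕ.<⇒≤ k<M) ⟩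
        c ℕ.* count (B<? k)                        ≤⟨ ℕ.*-monoʳ-≤ c (count-mono (B<? k) (B<? (suc k)) B<-mono) ⟩
        c ℕ.* count (B<? (suc k))                  ∎
        where
        open ℕ.≤-Reasoning
        j = fromℕ< k<M

  count-fibres : (c : ℕ) → (∀ {j} → B j → count (P? ∩? (λ i → g i Fin.≟ j)) ℕ.≤ c) → count P? ℕ.≤ c ℕ.* count B?
  count-fibres c fibre≤c = begin
    count P?                ≡⟨ count-cong P? (P<? M) ((λ p → p , Fin.toℕ<n _) , proj₁) ⟩
    count (P<? M)           ≤⟨ count-P<≤c*count-B< c fibre≤c M ℕ.≤-refl ⟩
    c ℕ.* count (B<? M)     ≡⟨ ≡.cong (c ℕ.*_) (count-cong (B<? M) B? (proj₁ , λ b → b , Fin.toℕ<n _)) ⟩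
    c ℕ.* count B?          ∎
    where open ℕ.≤-Reasoning

1+q^r≤q^[1+r] : ∀ {q} → 2 ℕ.≤ q → ∀ r → suc (q ℕ.^ r) ℕ.≤ q ℕ.^ suc r
1+q^r≤q^[1+r] {q} 2≤q r = begin
  1 ℕ.+ q ℕ.^ r             ≤⟨ ℕ.+-monoˡ-≤ _ (ℕ.m^n>0 q {{ℕ.>-nonZero (ℕ.≤-trans (s≤s z≤n) 2≤q)}} r) ⟩
  q ℕ.^ r ℕ.+ q ℕ.^ r       ≡⟨ ≡.cong (q ℕ.^ r ℕ.+_) (ℕ.+-identityʳ _) ⟨
  2 ℕ.* q ℕ.^ r             ≤⟨ ℕ.*-monoˡ-≤ (q ℕ.^ r) 2≤q ⟩
  q ℕ.* q ℕ.^ r             ∎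
  where open ℕ.≤-Reasoning

module FiniteFieldProperties (K : FiniteField) where
  open FiniteField K
  open import Algebra.Properties.CommutativeSemiring.Exp commutativeSemiring using (_^_; ^-congˡ; ^-homo-*; ^-assocʳ)
  open import Algebra.Properties.Monoid.Mult +-monoid using (×-homo-+) renaming (_×_ to _×ₙ_)
  open import Algebra.Properties.Ring ring using (+-identityʳ-unique; +-inverseˡ-unique; +-cancelʳ; x∙y⁻¹≈ε⇒x≈y; -1*x≈-x)
  import Algebra.Properties.CommutativeMonoid.Sum as Sum
  open import Algebra.Solver.Ring.NaturalCoefficients.Default commutativeSemiring using (solve; _:+_; _:*_; _:=_; con)
  open import Data.Fin.Permutation using (Permutation′; permutation)
  open import Relation.Binary.Reasoning.Setoid setoid

  x*y≈0⇒x≈0⊎y≈0 : ∀ {x y} → x * y ≈ 0# → x ≈ 0# ⊎ y ≈ 0#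
  x*y≈0⇒x≈0⊎y≈0 {x} {y} xy≈0 with x ≟ 0#
  ... | yes x≈0 = inj₁ x≈0
  ... | no x≉0 with inverse x x≉0
  ...   | x⁻¹ , xx⁻¹≈1 = inj₂ (begin
    y                ≈⟨ sym (*-identityˡ y) ⟩
    1# * y           ≈⟨ *-congʳ (sym xx⁻¹≈1) ⟩
    (x * x⁻¹) * y    ≈⟨ solve 3 (λ x x⁻¹ y → (x :* x⁻¹) :* y := x⁻¹ :* (x :* y)) refl x x⁻¹ y ⟩
    x⁻¹ * (x * y)    ≈⟨ *-congˡ xy≈0 ⟩
    x⁻¹ * 0#         ≈⟨ zeroʳ x⁻¹ ⟩
    0#               ∎)

  *-cancelʳ-nonZero : ∀ {x y z} → ¬ z ≈ 0# → x * z ≈ y * z → x ≈ y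
  *-cancelʳ-nonZero {x} {y} {z} z≉0 xz≈yz = begin
    x                ≈⟨ scale x ⟨
    (x * z) * z⁻¹    ≈⟨ *-congʳ xz≈yz ⟩
    (y * z) * z⁻¹    ≈⟨ scale y ⟩
    y                ∎
    where
    z⁻¹ = proj₁ (inverse z z≉0)
    scale : ∀ w → (w * z) * z⁻¹ ≈ w
    scale w = trans (*-assoc w z z⁻¹) (trans (*-congˡ (proj₂ (inverse z z≉0))) (*-identityʳ w))

  pow≡^ : ∀ x n → pow K x n ≡ x ^ n
  pow≡^ x zero    = ≡.refl
  pow≡^ x (suc n) = ≡.cong (x *_) (pow≡^ x n)

  pow-cong : ∀ n {x y} → x ≈ y → pow K x n ≈ pow K y n
  pow-cong n {x} {y} x≈y = begin
    pow K x n   ≡⟨ pow≡^ x n ⟩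
    x ^ n       ≈⟨ ^-congˡ n x≈y ⟩
    y ^ n       ≡⟨ pow≡^ y n ⟨
    pow K y n   ∎

  pow-+ : ∀ x m n → pow K x (m ℕ.+ n) ≈ pow K x m * pow K x n
  pow-+ x m n = begin
    pow K x (m ℕ.+ n)        ≡⟨ pow≡^ x (m ℕ.+ n) ⟩
    x ^ (m ℕ.+ n)            ≈⟨ ^-homo-* x m n ⟩
    x ^ m * x ^ n            ≡⟨ ≡.cong₂ _*_ (pow≡^ x m) (pow≡^ x n) ⟨
    pow K x m * pow K x n    ∎

  pow-* : ∀ x m n → pow K x (m ℕ.* n) ≈ pow K (pow K x m) n
  pow-* x m n = begin
    pow K x (m ℕ.* n)        ≡⟨ pow≡^ x (m ℕ.* n) ⟩
    x ^ (m ℕ.* n)            ≈⟨ ^-assocʳ x m n ⟨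
    (x ^ m) ^ n              ≡⟨ ≡.trans (pow≡^ (pow K x m) n) (≡.cong (_^ n) (pow≡^ x m)) ⟨
    pow K (pow K x m) n      ∎

  pow≈0⇒≈0 : ∀ {x} n → pow K x n ≈ 0# → x ≈ 0#
  pow≈0⇒≈0 zero    1≈0 = ⊥-elim (nontrivial 1≈0)
  pow≈0⇒≈0 (suc n) xxⁿ≈0 with x*y≈0⇒x≈0⊎y≈0 xxⁿ≈0
  ... | inj₁ x≈0  = x≈0
  ... | inj₂ xⁿ≈0 = pow≈0⇒≈0 n xⁿ≈0

  Σ<-cong : ∀ n {f g : ℕ → Carrier} → (∀ i → f i ≈ g i) → Σ< K n f ≈ Σ< K n g
  Σ<-cong zero    f≈g = refl
  Σ<-cong (suc n) f≈g = +-cong (Σ<-cong n f≈g) (f≈g n)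

  Σ<-+ : ∀ n f g → Σ< K n (λ i → f i + g i) ≈ Σ< K n f + Σ< K n g
  Σ<-+ zero    f g = sym (+-identityˡ 0#)
  Σ<-+ (suc n) f g = trans (+-congʳ (Σ<-+ n f g))
    (solve 4 (λ a b c d → (a :+ b) :+ (c :+ d) := (a :+ c) :+ (b :+ d)) refl (Σ< K n f) (Σ< K n g) (f n) (g n))

  *-distribˡ-Σ< : ∀ n c f → c * Σ< K n f ≈ Σ< K n (λ i → c * f i)
  *-distribˡ-Σ< zero    c f = zeroʳ c
  *-distribˡ-Σ< (suc n) c f = trans (distribˡ c _ _) (+-congʳ (*-distribˡ-Σ< n c f))

  *-distribʳ-Σ< : ∀ n c f → Σ< K n f * c ≈ Σ< K n (λ i → f i * c)
  *-distribʳ-Σ< n c f = trans (*-comm _ c) (trans (*-distribˡ-Σ< n c f) (Σ<-cong n (λ i → *-comm c (f i))))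

  Σ<-split : ∀ m n f → Σ< K (m ℕ.+ n) f ≈ Σ< K m f + Σ< K n (λ i → f (m ℕ.+ i))
  Σ<-split m zero    f = ≡.subst (λ e → Σ< K e f ≈ Σ< K m f + 0#) (≡.sym (ℕ.+-identityʳ m)) (sym (+-identityʳ _))
  Σ<-split m (suc n) f = ≡.subst (λ e → Σ< K e f ≈ Σ< K m f + Σ< K (suc n) (λ i → f (m ℕ.+ i))) (≡.sym (ℕ.+-suc m n))
    (trans (+-congʳ (Σ<-split m n f)) (+-assoc _ _ _))

  Σ<-shift : ∀ n f → Σ< K n (λ i → f (suc i)) + f 0 ≈ Σ< K n f + f n
  Σ<-shift zero    f = trans (+-identityˡ _) (sym (+-identityˡ _))
  Σ<-shift (suc n) f = begin
    (Σ< K n (λ i → f (suc i)) + f (suc n)) + f 0  ≈⟨ solve 3 (λ a b c → (a :+ b) :+ c := (a :+ c) :+ b) refl _ (f (suc n)) (f 0) ⟩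
    (Σ< K n (λ i → f (suc i)) + f 0) + f (suc n)  ≈⟨ +-congʳ (Σ<-shift n f) ⟩
    (Σ< K n f + f n) + f (suc n)                  ∎

  index : Carrier → Fin size
  index x = proj₁ (enum-surj x)

  enum-index : ∀ x → enum (index x) ≈ x
  enum-index x = proj₂ (enum-surj x)

  size-pos : 1 ℕ.≤ size
  size-pos = ℕ.>-nonZero⁻¹ size {{Fin.nonZeroIndex (index 0#)}}

  card : {P : Pred Carrier 0ℓ} → Decidable P → ℕ
  card P? = count (λ i → P? (enum i))

  card-cong : {P Q : Pred Carrier 0ℓ} (P? : Decidable P) (Q? : Decidable Q) → P ≐ Q → card P? ≡ card Q?
  card-cong P? Q? (P⊆Q , Q⊆P) = count-cong (λ i → P? (enum i)) (λ i → Q? (enum i)) (P⊆Q , Q⊆P)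

  card-mono : {P Q : Pred Carrier 0ℓ} (P? : Decidable P) (Q? : Decidable Q) → P ⊆ Q → card P? ℕ.≤ card Q?
  card-mono P? Q? P⊆Q = count-mono (λ i → P? (enum i)) (λ i → Q? (enum i)) P⊆Q

  mkInverse : (f g : Carrier → Carrier) → Congruent _≈_ _≈_ f → Congruent _≈_ _≈_ g
            → (∀ x → f (g x) ≈ x) → (∀ x → g (f x) ≈ x) → Inverse setoid setoid
  mkInverse f g f-cong g-cong fg gf = record
    { to = f ; from = g ; to-cong = f-cong ; from-cong = g-cong
    ; inverse = (λ y≈gx → trans (f-cong y≈gx) (fg _)) , (λ y≈fx → trans (g-cong y≈fx) (gf _)) }

  translation : Carrier → Inverse setoid setoid
  translation a = mkInverse (_+ a) (_- a) +-congʳ +-congʳ (cancel (- a) a (-‿inverseˡ a)) (cancel a (- a) (-‿inverseʳ a))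
    where
    cancel : ∀ b c → b + c ≈ 0# → ∀ x → (x + b) + c ≈ x
    cancel b c b+c≈0 x = trans (+-assoc x b c) (trans (+-congˡ b+c≈0) (+-identityʳ x))

  scaling : ∀ {a} → ¬ a ≈ 0# → Inverse setoid setoid
  scaling {a} a≉0 = mkInverse (a *_) (a⁻¹ *_) *-congˡ *-congˡ (cancel a a⁻¹ aa⁻¹≈1) (cancel a⁻¹ a (trans (*-comm a⁻¹ a) aa⁻¹≈1))
    where
    a⁻¹ = proj₁ (inverse a a≉0)
    aa⁻¹≈1 = proj₂ (inverse a a≉0)
    cancel : ∀ b c → b * c ≈ 1# → ∀ x → b * (c * x) ≈ x
    cancel b c bc≈1 x = trans (sym (*-assoc b c x)) (trans (*-congʳ bc≈1) (*-identityˡ x))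

  private
    module ∑ = Sum +-commutativeMonoid
    module ∏ = Sum *-commutativeMonoid

  enumPermutation : Inverse setoid setoid → Permutation′ size
  enumPermutation π = permutation (λ i → index (to (enum i))) (λ j → index (from (enum j)))
    (λ j → enum-inj _ _ (trans (enum-index _) (trans (to-cong (enum-index _)) (strictlyInverseˡ _))))
    (λ i → enum-inj _ _ (trans (enum-index _) (trans (from-cong (enum-index _)) (strictlyInverseʳ _))))
    where open Inverse π

  ∑-invariant : (π : Inverse setoid setoid) (f : Carrier → Carrier) → Congruent _≈_ _≈_ f
              → ∑.sum (λ i → f (enum i)) ≈ ∑.sum (λ i → f (Inverse.to π (enum i)))
  ∑-invariant π f f-cong = trans (∑.sum-permute _ (enumPermutation π)) (∑.sum-cong-≋ λ i → f-cong (enum-index (Inverse.to π (enum i))))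

  ∏-invariant : (π : Inverse setoid setoid) (f : Carrier → Carrier) → Congruent _≈_ _≈_ f
              → ∏.sum (λ i → f (enum i)) ≈ ∏.sum (λ i → f (Inverse.to π (enum i)))
  ∏-invariant π f f-cong = trans (∏.sum-permute _ (enumPermutation π)) (∏.sum-cong-≋ λ i → f-cong (enum-index (Inverse.to π (enum i))))

  card-translate : {P P′ : Pred Carrier 0ℓ} (P? : Decidable P) (P′? : Decidable P′) → P′ Respects _≈_
                  → (x₀ : Carrier) → (∀ {x} → P x → P′ (x + x₀)) → card P? ℕ.≤ card P′?
  card-translate P? P′? P′-resp x₀ P⇒P′ = count-inj _ _ (λ i → index (enum i + x₀))
    (λ p → P′-resp (sym (enum-index _)) (P⇒P′ p))
    (λ {i} {j} _ _ e → enum-inj i j (+-cancelʳ x₀ _ _ (trans (sym (enum-index _)) (trans (reflexive (≡.cong enum e)) (enum-index _)))))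

  size×1≈0 : size ×ₙ 1# ≈ 0#
  size×1≈0 = +-identityʳ-unique (∑.sum enum) _ (sym (begin
    ∑.sum enum                               ≈⟨ ∑-invariant (translation 1#) (λ x → x) (λ x≈y → x≈y) ⟩
    ∑.sum (λ i → enum i + 1#)                ≈⟨ ∑.∑-distrib-+ enum (λ _ → 1#) ⟩
    ∑.sum enum + ∑.sum {size} (λ _ → 1#)     ≈⟨ +-congˡ (∑.sum-replicate size) ⟩
    ∑.sum enum + size ×ₙ 1#                  ∎))

  2^n×1≈[1+1]^n : ∀ n → (2 ℕ.^ n) ×ₙ 1# ≈ pow K (1# + 1#) n
  2^n×1≈[1+1]^n zero    = +-identityʳ 1#
  2^n×1≈[1+1]^n (suc n) = begin
    (2 ℕ.^ n ℕ.+ (2 ℕ.^ n ℕ.+ 0)) ×ₙ 1#      ≡⟨ ≡.cong (λ e → (2 ℕ.^ n ℕ.+ e) ×ₙ 1#) (ℕ.+-identityʳ _) ⟩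
    (2 ℕ.^ n ℕ.+ 2 ℕ.^ n) ×ₙ 1#              ≈⟨ ×-homo-+ 1# (2 ℕ.^ n) (2 ℕ.^ n) ⟩
    (2 ℕ.^ n) ×ₙ 1# + (2 ℕ.^ n) ×ₙ 1#        ≈⟨ +-cong (2^n×1≈[1+1]^n n) (2^n×1≈[1+1]^n n) ⟩
    pow K (1# + 1#) n + pow K (1# + 1#) n    ≈⟨ solve 1 (λ p → p :+ p := (con 1 :+ con 1) :* p) refl _ ⟩
    (1# + 1#) * pow K (1# + 1#) n            ∎

  characteristic-2 : ∀ {n} → size ≡ 2 ℕ.^ n → 1# + 1# ≈ 0#
  characteristic-2 {n} size≡2ⁿ =
    pow≈0⇒≈0 n (trans (sym (2^n×1≈[1+1]^n n)) (≡.subst (λ e → e ×ₙ 1# ≈ 0#) size≡2ⁿ size×1≈0))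

  1#-if_else_ : {P : Set} → Dec P → Carrier → Carrier
  1#-if yes _ else a = 1#
  1#-if no _  else a = a

  ∏-1#-if-else : {P : Pred (Fin N) 0ℓ} (P? : Decidable P) (a : Carrier)
               → ∏.sum (λ i → 1#-if P? i else a) ≈ pow K a (count (∁? P?))
  ∏-1#-if-else {N = zero}  P? a = refl
  ∏-1#-if-else {N = suc N} P? a with P? Fin.zero
  ... | yes _ = trans (*-identityˡ _) (∏-1#-if-else (λ i → P? (Fin.suc i)) a)
  ... | no _  = *-congˡ (∏-1#-if-else (λ i → P? (Fin.suc i)) a)

  ∏-nonZero : (f : Fin N → Carrier) → (∀ i → ¬ f i ≈ 0#) → ¬ ∏.sum f ≈ 0#
  ∏-nonZero {N = zero}  f f≉0 1≈0 = nontrivial 1≈0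
  ∏-nonZero {N = suc N} f f≉0 ∏≈0 with x*y≈0⇒x≈0⊎y≈0 ∏≈0
  ... | inj₁ f₀≈0 = f≉0 Fin.zero f₀≈0
  ... | inj₂ ∏≈0′ = ∏-nonZero (λ i → f (Fin.suc i)) (λ i → f≉0 (Fin.suc i)) ∏≈0′

  isZero? : Decidable (λ i → enum i ≈ 0#)
  isZero? i = enum i ≟ 0#

  count-nonZero : count (∁? isZero?) ≡ size ℕ.∸ 1
  count-nonZero = ≡.trans (≡.sym (ℕ.m+n∸m≡n (count isZero?) _))
                          (≡.cong₂ ℕ._∸_ (count-+-count-∁ isZero?) count-isZero)
    where
    count-isZero : count isZero? ≡ 1
    count-isZero = ℕ.≤-antisym (count-≤1 isZero? (λ p q → enum-inj _ _ (trans p (sym q))))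
                               (count-pos isZero? (enum-index 0#))

  zero↦one : Carrier → Carrier
  zero↦one x = 1#-if (x ≟ 0#) else x

  zero↦one≉0 : ∀ x → ¬ zero↦one x ≈ 0#
  zero↦one≉0 x with x ≟ 0#
  ... | yes _ = nontrivial
  ... | no x≉0 = x≉0

  zero↦one-cong : Congruent _≈_ _≈_ zero↦one
  zero↦one-cong {x} {y} x≈y with x ≟ 0# | y ≟ 0#
  ... | yes _   | yes _   = refl
  ... | no _    | no _    = x≈y
  ... | yes x≈0 | no y≉0  = ⊥-elim (y≉0 (trans (sym x≈y) x≈0))
  ... | no x≉0  | yes y≈0 = ⊥-elim (x≉0 (trans x≈y y≈0))

  zero↦one-* : ∀ {a} → ¬ a ≈ 0# → ∀ x → zero↦one (a * x) ≈ (1#-if (x ≟ 0#) else a) * zero↦one x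
  zero↦one-* {a} a≉0 x with x ≟ 0# | (a * x) ≟ 0#
  ... | yes _   | yes _    = sym (*-identityˡ 1#)
  ... | no _    | no _     = refl
  ... | yes x≈0 | no ax≉0  = ⊥-elim (ax≉0 (trans (*-congˡ x≈0) (zeroʳ a)))
  ... | no x≉0  | yes ax≈0 with x*y≈0⇒x≈0⊎y≈0 ax≈0
  ...   | inj₁ a≈0 = ⊥-elim (a≉0 a≈0)
  ...   | inj₂ x≈0 = ⊥-elim (x≉0 x≈0)

  -- Multiplication by a permutes K and fixes 0, so it multiplies the product of the nonzero
  -- elements by a^(size - 1).
  pow-size∸1 : ∀ {a} → ¬ a ≈ 0# → pow K a (size ℕ.∸ 1) ≈ 1#
  pow-size∸1 {a} a≉0 = *-cancelʳ-nonZero (∏-nonZero _ (λ i → zero↦one≉0 (enum i))) (sym (begin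
    1# * ∏                                               ≈⟨ *-identityˡ ∏ ⟩
    ∏                                                    ≈⟨ ∏-invariant (scaling a≉0) zero↦one zero↦one-cong ⟩
    ∏.sum (λ i → zero↦one (a * enum i))                  ≈⟨ ∏.sum-cong-≋ (λ i → zero↦one-* a≉0 (enum i)) ⟩
    ∏.sum (λ i → (1#-if isZero? i else a) * zero↦one (enum i))
                                                         ≈⟨ ∏.∑-distrib-+ (λ i → 1#-if isZero? i else a) _ ⟩
    ∏.sum (λ i → 1#-if isZero? i else a) * ∏             ≈⟨ *-congʳ (∏-1#-if-else isZero? a) ⟩
    pow K a (count (∁? isZero?)) * ∏                     ≡⟨ ≡.cong (λ e → pow K a e * ∏) count-nonZero ⟩
    pow K a (size ℕ.∸ 1) * ∏                             ∎))
    where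
    ∏ = ∏.sum (λ i → zero↦one (enum i))

  pow-size : ∀ x → pow K x size ≈ x
  pow-size x = ≡.subst (λ e → pow K x e ≈ x) (ℕ.m+[n∸m]≡n size-pos) (x*x^[size∸1]≈x (x ≟ 0#))
    where
    x*x^[size∸1]≈x : Dec (x ≈ 0#) → x * pow K x (size ℕ.∸ 1) ≈ x
    x*x^[size∸1]≈x (yes x≈0) = trans (*-congʳ x≈0) (trans (zeroˡ _) (sym x≈0))
    x*x^[size∸1]≈x (no x≉0)  = trans (*-congˡ (pow-size∸1 x≉0)) (*-identityʳ x)

  -- evalMonic cs is the monic polynomial of degree length cs whose lower coefficients are cs.
  evalMonic : List Carrier → Carrier → Carrier
  evalMonic []       x = 1#
  evalMonic (c ∷ cs) x = c + x * evalMonic cs x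

  eval : List Carrier → Carrier → Carrier
  eval []       x = 0#
  eval (c ∷ cs) x = c + x * eval cs x

  deflate : Carrier → List Carrier → List Carrier
  deflate a []       = []
  deflate a (c ∷ cs) = evalMonic (c ∷ cs) a ∷ deflate a cs

  length-deflate : ∀ a cs → length (deflate a cs) ≡ length cs
  length-deflate a []       = ≡.refl
  length-deflate a (c ∷ cs) = ≡.cong suc (length-deflate a cs)

  x+[a-a]y≈x : ∀ a x y → x + (a - a) * y ≈ x
  x+[a-a]y≈x a x y = trans (+-congˡ (trans (*-congʳ (-‿inverseʳ a)) (zeroˡ y))) (+-identityʳ x)

  factor-theorem : ∀ a c cs x
                 → evalMonic (c ∷ cs) x ≈ evalMonic (c ∷ cs) a + (x - a) * evalMonic (deflate a cs) x
  factor-theorem a c [] x = begin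
    c + x * 1#                                  ≈⟨ x+[a-a]y≈x a (c + x * 1#) 1# ⟨
    (c + x * 1#) + (a - a) * 1#                 ≈⟨ solve 4 (λ a b c x → (c :+ x :* con 1) :+ (a :+ b) :* con 1
                                                               := (c :+ a :* con 1) :+ (x :+ b) :* con 1) refl a (- a) c x ⟩
    (c + a * 1#) + (x - a) * 1#                 ∎
  factor-theorem a c (c′ ∷ cs) x = begin
    c + x * h x                                 ≈⟨ +-congˡ (*-congˡ (factor-theorem a c′ cs x)) ⟩
    c + x * (h a + (x - a) * r)                 ≈⟨ x+[a-a]y≈x a (c + x * (h a + (x - a) * r)) (h a) ⟨
    c + x * (h a + (x - a) * r) + (a - a) * h a
        ≈⟨ solve 6 (λ a b c x ha r → c :+ x :* (ha :+ (x :+ b) :* r) :+ (a :+ b) :* ha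
                                   := (c :+ a :* ha) :+ (x :+ b) :* (ha :+ x :* r)) refl a (- a) c x (h a) r ⟩
    (c + a * h a) + (x - a) * (h a + x * r)     ∎
    where
    h = evalMonic (c′ ∷ cs)
    r = evalMonic (deflate a cs) x

  isRoot? : (f : Carrier → Carrier) → Decidable (λ x → f x ≈ 0#)
  isRoot? f x = f x ≟ 0#

  IsMonicOfDegree : ℕ → (Carrier → Carrier) → Set
  IsMonicOfDegree d f = Σ (List Carrier) λ cs → length cs ≡ d × (∀ x → f x ≈ evalMonic cs x)

  card-roots : ∀ {d f} → IsMonicOfDegree d f → card (isRoot? f) ℕ.≤ d
  card-roots {zero} {f} ([] , _ , f≈1) =
    ℕ.≤-reflexive (count-empty _ (λ i f≈0 → nontrivial (trans (sym (f≈1 (enum i))) f≈0)))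
  card-roots {suc d} {f} (c ∷ cs , ∣cs∣≡d , f≈p) with Fin.any? (λ i → isRoot? f (enum i))
  ... | no noRoot = ℕ.≤-trans (ℕ.≤-reflexive (count-empty _ (λ i root → noRoot (i , root)))) z≤n
  ... | yes (i₀ , a-root) =
    ℕ.≤-trans (count-∪ _ (Fin._≟ i₀) (λ i → isRoot? q (enum i)) root-split)
              (ℕ.+-mono-≤ (count-≤1 (Fin._≟ i₀) (λ e e′ → ≡.trans e (≡.sym e′)))
                          (card-roots (deflate a cs , ≡.trans (length-deflate a cs) (ℕ.suc-injective ∣cs∣≡d) , λ _ → refl)))
    where
    a = enum i₀
    q = evalMonic (deflate a cs)
    root-split : ∀ {i} → f (enum i) ≈ 0# → i ≡ i₀ ⊎ q (enum i) ≈ 0#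
    root-split {i} root with x*y≈0⇒x≈0⊎y≈0 (begin
        (enum i - a) * q (enum i)                      ≈⟨ +-identityˡ _ ⟨
        0# + (enum i - a) * q (enum i)                 ≈⟨ +-congʳ (trans (sym (f≈p a)) a-root) ⟨
        evalMonic (c ∷ cs) a + (enum i - a) * q (enum i) ≈⟨ factor-theorem a c cs (enum i) ⟨
        evalMonic (c ∷ cs) (enum i)                    ≈⟨ f≈p (enum i) ⟨
        f (enum i)                                     ≈⟨ root ⟩
        0#                                             ∎)
    ... | inj₁ x-a≈0 = inj₁ (enum-inj i i₀ (x∙y⁻¹≈ε⇒x≈y _ _ x-a≈0))
    ... | inj₂ q≈0   = inj₂ q≈0

  HasDegree< : ℕ → (Carrier → Carrier) → Set
  HasDegree< d g = Σ (List Carrier) λ cs → length cs ℕ.≤ d × (∀ x → g x ≈ eval cs x)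

  isMonic-cong : ∀ {d f g} → (∀ x → f x ≈ g x) → IsMonicOfDegree d g → IsMonicOfDegree d f
  isMonic-cong f≈g (cs , ∣cs∣≡d , g≈p) = cs , ∣cs∣≡d , λ x → trans (f≈g x) (g≈p x)

  pow-isMonic : ∀ e → IsMonicOfDegree e (λ x → pow K x e)
  pow-isMonic e = replicate e 0# , Data.List.Properties.length-replicate e , pow≈evalMonic e
    where
    pow≈evalMonic : ∀ e x → pow K x e ≈ evalMonic (replicate e 0#) x
    pow≈evalMonic zero    x = refl
    pow≈evalMonic (suc e) x = trans (*-congˡ (pow≈evalMonic e x)) (sym (+-identityˡ _))

  isMonic⇒hasDegree< : ∀ {d f} → IsMonicOfDegree d f → HasDegree< (suc d) f
  isMonic⇒hasDegree< {d} (cs , ∣cs∣≡d , f≈p) =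
    cs ++ 1# ∷ [] , ℕ.≤-reflexive ∣cs++1∣≡1+d , λ x → trans (f≈p x) (evalMonic≈eval cs x)
    where
    ∣cs++1∣≡1+d : length (cs ++ 1# ∷ []) ≡ suc d
    ∣cs++1∣≡1+d = ≡.trans (Data.List.Properties.length-++ cs) (≡.trans (ℕ.+-comm _ 1) (≡.cong suc ∣cs∣≡d))
    evalMonic≈eval : ∀ cs x → evalMonic cs x ≈ eval (cs ++ 1# ∷ []) x
    evalMonic≈eval []       x = sym (trans (+-congˡ (zeroʳ x)) (+-identityʳ 1#))
    evalMonic≈eval (c ∷ cs) x = +-congˡ (*-congˡ (evalMonic≈eval cs x))

  hasDegree<-mono : ∀ {d d′ g} → d ℕ.≤ d′ → HasDegree< d g → HasDegree< d′ g
  hasDegree<-mono d≤d′ (cs , ∣cs∣≤d , g≈p) = cs , ℕ.≤-trans ∣cs∣≤d d≤d′ , g≈p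

  +-isMonic : ∀ {d f g} → HasDegree< d g → IsMonicOfDegree d f → IsMonicOfDegree d (λ x → g x + f x)
  +-isMonic (xs , ∣xs∣≤d , g≈p) (ys , ∣ys∣≡d , f≈q) =
    add xs ys , ≡.trans (length-add xs ys ∣xs∣≤∣ys∣) ∣ys∣≡d ,
    λ x → trans (+-cong (g≈p x) (f≈q x)) (eval+evalMonic xs ys x ∣xs∣≤∣ys∣)
    where
    ∣xs∣≤∣ys∣ = ℕ.≤-trans ∣xs∣≤d (ℕ.≤-reflexive (≡.sym ∣ys∣≡d))
    add : List Carrier → List Carrier → List Carrier
    add []       ys       = ys
    add (x ∷ xs) []       = x ∷ xs
    add (x ∷ xs) (y ∷ ys) = x + y ∷ add xs ys
    length-add : ∀ xs ys → length xs ℕ.≤ length ys → length (add xs ys) ≡ length ys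
    length-add []       ys       _         = ≡.refl
    length-add (x ∷ xs) (y ∷ ys) (s≤s le) = ≡.cong suc (length-add xs ys le)
    eval+evalMonic : ∀ xs ys z → length xs ℕ.≤ length ys → eval xs z + evalMonic ys z ≈ evalMonic (add xs ys) z
    eval+evalMonic []       ys       z _        = +-identityˡ _
    eval+evalMonic (x ∷ xs) (y ∷ ys) z (s≤s le) = begin
      (x + z * eval xs z) + (y + z * evalMonic ys z)  ≈⟨ solve 5 (λ x y z p q → (x :+ z :* p) :+ (y :+ z :* q) := (x :+ y) :+ z :* (p :+ q))
                                                                refl x y z (eval xs z) (evalMonic ys z) ⟩
      (x + y) + z * (eval xs z + evalMonic ys z)      ≈⟨ +-congˡ (*-congˡ (eval+evalMonic xs ys z le)) ⟩
      (x + y) + z * evalMonic (add xs ys) z           ∎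

  card-pow-fixed : ∀ {e} → 2 ℕ.≤ e → card (λ x → pow K x e ≟ x) ℕ.≤ e
  card-pow-fixed {e} 2≤e = ℕ.≤-trans
    (count-mono _ (λ i → isRoot? (λ x → - x + pow K x e) (enum i)) (λ {i} xᵉ≈x → trans (+-congˡ xᵉ≈x) (-‿inverseˡ (enum i))))
    (card-roots (+-isMonic (hasDegree<-mono 2≤e (0# ∷ - 1# ∷ [] , ℕ.≤-refl , -x≈eval)) (pow-isMonic e)))
    where
    -x≈eval : ∀ x → - x ≈ 0# + x * (- 1# + x * 0#)
    -x≈eval x = begin
      - x                      ≈⟨ -1*x≈-x x ⟨
      - 1# * x                 ≈⟨ *-comm _ x ⟩
      x * - 1#                 ≈⟨ *-congˡ (+-identityʳ _) ⟨
      x * (- 1# + 0#)          ≈⟨ *-congˡ (+-congˡ (zeroʳ x)) ⟨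
      x * (- 1# + x * 0#)      ≈⟨ +-identityˡ _ ⟨
      0# + x * (- 1# + x * 0#) ∎

  Σ<-pow-isMonic : ∀ {q} → 2 ℕ.≤ q → ∀ r → IsMonicOfDegree (q ℕ.^ r) (λ x → Σ< K (suc r) (λ i → pow K x (q ℕ.^ i)))
  Σ<-pow-isMonic 2≤q zero    = isMonic-cong (λ x → +-identityˡ _) (pow-isMonic 1)
  Σ<-pow-isMonic {q} 2≤q (suc r) =
    +-isMonic (hasDegree<-mono (1+q^r≤q^[1+r] 2≤q r) (isMonic⇒hasDegree< (Σ<-pow-isMonic 2≤q r))) (pow-isMonic (q ℕ.^ suc r))

  module Characteristic2 (1+1≈0 : 1# + 1# ≈ 0#) where

    x+x≈0 : ∀ x → x + x ≈ 0#
    x+x≈0 x = trans (solve 1 (λ x → x :+ x := (con 1 :+ con 1) :* x) refl x) (trans (*-congʳ 1+1≈0) (zeroˡ x))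

    x+y≈0⇒x≈y : ∀ {x y} → x + y ≈ 0# → x ≈ y
    x+y≈0⇒x≈y {x} {y} x+y≈0 = trans (+-inverseˡ-unique x y x+y≈0) (sym (+-inverseˡ-unique y y (x+x≈0 y)))

    x≈y⇒x+y≈0 : ∀ {x y} → x ≈ y → x + y ≈ 0#
    x≈y⇒x+y≈0 {x} {y} x≈y = trans (+-congʳ x≈y) (x+x≈0 y)

    [x+y]²≈x²+y² : ∀ x y → (x + y) * (x + y) ≈ x * x + y * y
    [x+y]²≈x²+y² x y = begin
      (x + y) * (x + y)                  ≈⟨ solve 2 (λ x y → (x :+ y) :* (x :+ y) := (x :* y :+ x :* y) :+ (x :* x :+ y :* y)) refl x y ⟩
      (x * y + x * y) + (x * x + y * y)  ≈⟨ +-congʳ (x+x≈0 (x * y)) ⟩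
      0# + (x * x + y * y)               ≈⟨ +-identityˡ _ ⟩
      x * x + y * y                      ∎

    square-injective : ∀ {x y} → x * x ≈ y * y → x ≈ y
    square-injective {x} {y} x²≈y² with x*y≈0⇒x≈0⊎y≈0 (trans ([x+y]²≈x²+y² x y) (x≈y⇒x+y≈0 x²≈y²))
    ... | inj₁ x+y≈0 = x+y≈0⇒x≈y x+y≈0
    ... | inj₂ x+y≈0 = x+y≈0⇒x≈y x+y≈0

    frobenius : ∀ e x y → pow K (x + y) (2 ℕ.^ e) ≈ pow K x (2 ℕ.^ e) + pow K y (2 ℕ.^ e)
    frobenius zero    x y = trans (*-identityʳ _) (+-cong (sym (*-identityʳ x)) (sym (*-identityʳ y)))
    frobenius (suc e) x y = begin
      pow K (x + y) (2 ℕ.^ suc e)                      ≈⟨ square (x + y) ⟩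
      pow K (x + y) (2 ℕ.^ e) * pow K (x + y) (2 ℕ.^ e) ≈⟨ *-cong (frobenius e x y) (frobenius e x y) ⟩
      (X + Y) * (X + Y)                                ≈⟨ [x+y]²≈x²+y² X Y ⟩
      X * X + Y * Y                                    ≈⟨ +-cong (square x) (square y) ⟨
      pow K x (2 ℕ.^ suc e) + pow K y (2 ℕ.^ suc e)    ∎
      where
      X = pow K x (2 ℕ.^ e)
      Y = pow K y (2 ℕ.^ e)
      square : ∀ z → pow K z (2 ℕ.^ suc e) ≈ pow K z (2 ℕ.^ e) * pow K z (2 ℕ.^ e)
      square z = trans (pow-+ z (2 ℕ.^ e) _) (*-congˡ (reflexive (≡.cong (pow K z) (ℕ.+-identityʳ (2 ℕ.^ e)))))

    frobenius-Σ< : ∀ e n f → pow K (Σ< K n f) (2 ℕ.^ e) ≈ Σ< K n (λ i → pow K (f i) (2 ℕ.^ e))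
    frobenius-Σ< e zero    f = ≡.subst (λ n → pow K 0# n ≈ 0#) (ℕ.m+[n∸m]≡n (ℕ.m^n>0 2 e)) (zeroˡ _)
    frobenius-Σ< e (suc n) f = trans (frobenius e _ _) (+-congʳ (frobenius-Σ< e n f))

    module _ (q M : ℕ) {γ : Carrier} (periodic : pow K γ (q ℕ.^ M) ≈ γ) where

      private
        a : ℕ → Carrier
        a i = pow K γ (q ℕ.^ i)

        a-periodic : ∀ i → a (M ℕ.+ i) ≈ a i
        a-periodic i = begin
          pow K γ (q ℕ.^ (M ℕ.+ i))         ≡⟨ ≡.cong (pow K γ) (ℕ.^-distribˡ-+-* q M i) ⟩
          pow K γ (q ℕ.^ M ℕ.* q ℕ.^ i)     ≈⟨ pow-* γ (q ℕ.^ M) (q ℕ.^ i) ⟩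
          pow K (pow K γ (q ℕ.^ M)) (q ℕ.^ i) ≈⟨ pow-cong (q ℕ.^ i) periodic ⟩
          pow K γ (q ℕ.^ i)                 ∎

      Tr-periodic : Tr K q (M ℕ.+ M) γ ≈ 0#
      Tr-periodic = trans (Σ<-split M M a) (trans (+-congˡ (Σ<-cong M a-periodic)) (x+x≈0 _))

      St-periodic : St K q (M ℕ.+ M) γ ≈ Tr K q M γ * Tr K q M γ
      St-periodic = begin
        Σ< K (M ℕ.+ M) b                           ≈⟨ Σ<-split M M b ⟩
        S + Σ< K M (λ j → b (M ℕ.+ j))             ≈⟨ +-congˡ (Σ<-cong M b-shift) ⟩
        S + Σ< K M (λ j → T * a j + b j)           ≈⟨ +-congˡ (Σ<-+ M _ _) ⟩
        S + (Σ< K M (λ j → T * a j) + S)           ≈⟨ +-congˡ (+-congʳ (*-distribˡ-Σ< M T a)) ⟨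
        S + (T * T + S)                            ≈⟨ solve 2 (λ s t → s :+ (t :+ s) := t :+ (s :+ s)) refl S (T * T) ⟩
        T * T + (S + S)                            ≈⟨ +-congˡ (x+x≈0 S) ⟩
        T * T + 0#                                 ≈⟨ +-identityʳ _ ⟩
        T * T                                      ∎
        where
        T = Tr K q M γ
        b : ℕ → Carrier
        b j = Σ< K j (λ i → a i * a j)
        S = Σ< K M b
        b-shift : ∀ j → b (M ℕ.+ j) ≈ T * a j + b j
        b-shift j = begin
          Σ< K (M ℕ.+ j) (λ i → a i * a (M ℕ.+ j))            ≈⟨ Σ<-split M j _ ⟩
          Σ< K M (λ i → a i * a (M ℕ.+ j)) + Σ< K j (λ i → a (M ℕ.+ i) * a (M ℕ.+ j))
                  ≈⟨ +-cong (Σ<-cong M (λ i → *-congˡ (a-periodic j))) (Σ<-cong j (λ i → *-cong (a-periodic i) (a-periodic j))) ⟩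
          Σ< K M (λ i → a i * a j) + b j                      ≈⟨ +-congʳ (*-distribʳ-Σ< M (a j) a) ⟨
          T * a j + b j                                       ∎

    module AdditiveMap {A : Pred Carrier 0ℓ} (A? : Decidable A) (A-resp : A Respects _≈_)
                       (A-+ : ∀ {x y} → A x → A y → A (x + y))
                       (F : Carrier → Carrier) (F-cong : Congruent _≈_ _≈_ F)
                       (F-+ : ∀ {x y} → A x → A y → F (x + y) ≈ F x + F y) where

      Fibre : Carrier → Pred Carrier 0ℓ
      Fibre b x = A x × F x ≈ b

      fibre? : ∀ b → Decidable (Fibre b)
      fibre? b x = A? x ×-dec (F x ≟ b)

      Fibre-resp : ∀ b → Fibre b Respects _≈_
      Fibre-resp b x≈y (a , Fx≈b) = A-resp x≈y a , trans (F-cong (sym x≈y)) Fx≈b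

      card-fibre≤card-kernel : ∀ b → card (fibre? b) ℕ.≤ card (fibre? 0#)
      card-fibre≤card-kernel b with Fin.any? (λ i → fibre? b (enum i))
      ... | no empty = ℕ.≤-trans (ℕ.≤-reflexive (count-empty _ (λ i p → empty (i , p)))) z≤n
      ... | yes (i₀ , a₀ , Fx₀≈b) = card-translate (fibre? b) (fibre? 0#) (Fibre-resp 0#) (enum i₀)
              λ (a , Fx≈b) → A-+ a a₀ , trans (F-+ a a₀) (trans (+-cong Fx≈b Fx₀≈b) (x+x≈0 b))

      card-kernel≤card-fibre : ∀ {b x₀} → Fibre b x₀ → card (fibre? 0#) ℕ.≤ card (fibre? b)
      card-kernel≤card-fibre {b} {x₀} (a₀ , Fx₀≈b) = card-translate (fibre? 0#) (fibre? b) (Fibre-resp b) x₀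
        λ (a , Fx≈0) → A-+ a a₀ , trans (F-+ a a₀) (trans (+-cong Fx≈0 Fx₀≈b) (+-identityˡ b))

      card-domain≤card-kernel*card-image : {B : Pred Carrier 0ℓ} (B? : Decidable B) → B Respects _≈_
                                         → (∀ {x} → A x → B (F x)) → card A? ℕ.≤ card (fibre? 0#) ℕ.* card B?
      card-domain≤card-kernel*card-image B? B-resp A⇒BF =
        count-fibres _ _ (λ i → index (F (enum i))) (λ a → B-resp (sym (enum-index _)) (A⇒BF a)) (card (fibre? 0#))
          λ {j} _ → ℕ.≤-trans (ℕ.≤-reflexive (count-cong _ (λ i → fibre? (enum j) (enum i))
                      ((λ (a , e) → a , trans (sym (enum-index _)) (reflexive (≡.cong enum e)))
                      , (λ (a , e) → a , enum-inj _ _ (trans (enum-index _) e)))))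
                      (card-fibre≤card-kernel (enum j))

module RelativeTrace (K : FiniteField) (k M n : ℕ) (1≤k : 1 ℕ.≤ k) (1≤M : 1 ℕ.≤ M) (n≡M+M : n ≡ M ℕ.+ M)
                     (size≡qⁿ : FiniteField.size K ≡ (2 ℕ.^ k) ℕ.^ n) where
  open FiniteField K
  open FiniteFieldProperties K
  open import Algebra.Properties.Ring ring using (+-cancelʳ)
  open Characteristic2 (characteristic-2 {k ℕ.* n} (≡.trans size≡qⁿ (ℕ.^-*-assoc 2 k n)))
  open import Algebra.Solver.Ring.NaturalCoefficients.Default commutativeSemiring using (solve; _:+_; _:=_)

  q : ℕ
  q = 2 ℕ.^ k

  size≡q^[M+M] : size ≡ q ℕ.^ (M ℕ.+ M)
  size≡q^[M+M] = ≡.trans size≡qⁿ (≡.cong (q ℕ.^_) n≡M+M)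

  2≤q : 2 ℕ.≤ q
  2≤q = ℕ.^-monoʳ-≤ 2 1≤k

  φ : ℕ → Carrier → Carrier
  φ j x = pow K x (q ℕ.^ j)

  φ-+ : ∀ j x y → φ j (x + y) ≈ φ j x + φ j y
  φ-+ j x y = ≡.subst (λ e → pow K (x + y) e ≈ pow K x e + pow K y e) (≡.sym (ℕ.^-*-assoc 2 k j)) (frobenius (k ℕ.* j) x y)

  φ-∘ : ∀ i j x → pow K (φ j x) (q ℕ.^ i) ≈ φ (j ℕ.+ i) x
  φ-∘ i j x = sym (≡.subst (λ e → pow K x e ≈ pow K (φ j x) (q ℕ.^ i)) (≡.sym (ℕ.^-distribˡ-+-* q j i)) (pow-* x (q ℕ.^ j) (q ℕ.^ i)))

  L : Carrier → Carrier
  L x = φ M x + x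

  L-cong : Congruent _≈_ _≈_ L
  L-cong x≈y = +-cong (pow-cong (q ℕ.^ M) x≈y) x≈y

  L-+ : ∀ x y → L (x + y) ≈ L x + L y
  L-+ x y = trans (+-congʳ (φ-+ M x y))
    (solve 4 (λ a b x y → (a :+ b) :+ (x :+ y) := (a :+ x) :+ (b :+ y)) refl (φ M x) (φ M y) x y)

  -- With M = 2 * m this is definitionally InR K q m 0#, the paper's R₀.
  InR₀ : Pred Carrier 0ℓ
  InR₀ x = L x ≈ 0#

  InR₀? : Decidable InR₀
  InR₀? x = L x ≟ 0#

  InR₀-resp : InR₀ Respects _≈_
  InR₀-resp x≈y Lx≈0 = trans (L-cong (sym x≈y)) Lx≈0

  InR₀-+ : ∀ {x y} → InR₀ x → InR₀ y → InR₀ (x + y)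
  InR₀-+ Lx≈0 Ly≈0 = trans (L-+ _ _) (trans (+-cong Lx≈0 Ly≈0) (+-identityˡ 0#))

  φ-fixes-R₀ : ∀ {x} → InR₀ x → φ M x ≈ x
  φ-fixes-R₀ = x+y≈0⇒x≈y

  L-image⊆R₀ : ∀ x → InR₀ (L x)
  L-image⊆R₀ x = begin
    φ M (φ M x + x) + (φ M x + x)               ≈⟨ +-congʳ (φ-+ M _ _) ⟩
    (pow K (φ M x) (q ℕ.^ M) + φ M x) + (φ M x + x) ≈⟨ +-congʳ (+-congʳ (φ-∘ M M x)) ⟩
    (φ (M ℕ.+ M) x + φ M x) + (φ M x + x)       ≡⟨ ≡.cong (λ e → (pow K x e + φ M x) + (φ M x + x)) (≡.sym size≡q^[M+M]) ⟩
    (pow K x size + φ M x) + (φ M x + x)        ≈⟨ +-congʳ (+-congʳ (pow-size x)) ⟩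
    (x + φ M x) + (φ M x + x)                   ≈⟨ x≈y⇒x+y≈0 (+-comm x (φ M x)) ⟩
    0#                                          ∎
    where open import Relation.Binary.Reasoning.Setoid setoid

  T : Carrier → Carrier
  T = Tr K q M

  T-cong : Congruent _≈_ _≈_ T
  T-cong x≈y = Σ<-cong M (λ i → pow-cong (q ℕ.^ i) x≈y)

  T-+ : ∀ x y → T (x + y) ≈ T x + T y
  T-+ x y = trans (Σ<-cong M (λ i → φ-+ i x y)) (Σ<-+ M _ _)

  T-image⊆GF[q] : ∀ {x} → InR₀ x → pow K (T x) q ≈ T x
  T-image⊆GF[q] {x} x∈R₀ = begin
    pow K (T x) q                        ≈⟨ frobenius-Σ< k M (λ i → φ i x) ⟩
    Σ< K M (λ i → pow K (φ i x) q)        ≈⟨ Σ<-cong M (λ i → trans (sym (pow-* x (q ℕ.^ i) q)) (reflexive (≡.cong (pow K x) (ℕ.*-comm (q ℕ.^ i) q)))) ⟩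
    Σ< K M (λ i → φ (suc i) x)            ≈⟨ +-cancelʳ x _ _ shifted ⟩
    T x                                  ∎
    where
    open import Relation.Binary.Reasoning.Setoid setoid
    shifted : Σ< K M (λ i → φ (suc i) x) + x ≈ T x + x
    shifted = trans (+-congˡ (sym (*-identityʳ x))) (trans (Σ<-shift M (λ i → φ i x)) (+-congˡ (φ-fixes-R₀ x∈R₀)))

  GF[q]? : Decidable (λ v → pow K v q ≈ v)
  GF[q]? v = pow K v q ≟ v

  private
    module Lmap = AdditiveMap {A = λ _ → ⊤} (λ _ → yes tt) (λ _ _ → tt) (λ _ _ → tt) L L-cong (λ {x} {y} _ _ → L-+ x y)
    module Tmap = AdditiveMap InR₀? InR₀-resp InR₀-+ T T-cong (λ {x} {y} _ _ → T-+ x y)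

  κ : ℕ
  κ = card (Tmap.fibre? 0#)

  -- L maps K into R₀ with kernel R₀, so q^M · q^M = |K| ≤ |R₀|².
  q^M≤card-R₀ : q ℕ.^ M ℕ.≤ card InR₀?
  q^M≤card-R₀ = ℕ.≮⇒≥ λ card<q^M → ℕ.<⇒≱ (ℕ.*-mono-< card<q^M card<q^M) (begin
    q ℕ.^ M ℕ.* q ℕ.^ M                  ≡⟨ ≡.trans size≡q^[M+M] (ℕ.^-distribˡ-+-* q M M) ⟨
    size                                 ≡⟨ count-universal {P = λ _ → ⊤} _ (λ _ → tt) ⟨
    card {P = λ _ → ⊤} (λ _ → yes tt)    ≤⟨ Lmap.card-domain≤card-kernel*card-image InR₀? InR₀-resp (λ _ → L-image⊆R₀ _) ⟩
    card (Lmap.fibre? 0#) ℕ.* card InR₀? ≡⟨ ≡.cong (ℕ._* card InR₀?) (card-cong (Lmap.fibre? 0#) InR₀? (proj₂ , (tt ,_))) ⟩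
    card InR₀? ℕ.* card InR₀?            ∎)
    where open ℕ.≤-Reasoning

  GF[q]-resp : (λ v → pow K v q ≈ v) Respects _≈_
  GF[q]-resp u≈v uᵠ≈u = trans (pow-cong q (sym u≈v)) (trans uᵠ≈u u≈v)

  card-R₀≤κ*card-GF[q] : card InR₀? ℕ.≤ κ ℕ.* card GF[q]?
  card-R₀≤κ*card-GF[q] = Tmap.card-domain≤card-kernel*card-image GF[q]? GF[q]-resp T-image⊆GF[q]

  1+[M∸1]≡M : suc (M ℕ.∸ 1) ≡ M
  1+[M∸1]≡M = ℕ.m+[n∸m]≡n 1≤M

  κ≤q^[M∸1] : κ ℕ.≤ q ℕ.^ (M ℕ.∸ 1)
  κ≤q^[M∸1] = ℕ.≤-trans (card-mono (Tmap.fibre? 0#) (isRoot? (λ x → Σ< K (suc (M ℕ.∸ 1)) (λ i → φ i x))) kernel⊆roots)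
                        (card-roots (Σ<-pow-isMonic 2≤q (M ℕ.∸ 1)))
    where
    kernel⊆roots : ∀ {x} → InR₀ x × T x ≈ 0# → Σ< K (suc (M ℕ.∸ 1)) (λ i → φ i x) ≈ 0#
    kernel⊆roots {x} (_ , Tx≈0) = ≡.subst (λ n → Σ< K n (λ i → φ i x) ≈ 0#) (≡.sym 1+[M∸1]≡M) Tx≈0

  q^M≡q^[M∸1]*q : q ℕ.^ M ≡ q ℕ.^ (M ℕ.∸ 1) ℕ.* q
  q^M≡q^[M∸1]*q = ≡.trans (≡.cong (q ℕ.^_) (≡.sym 1+[M∸1]≡M)) (ℕ.*-comm q _)

  κ≡q^[M∸1] : κ ≡ q ℕ.^ (M ℕ.∸ 1)
  κ≡q^[M∸1] = ℕ.≤-antisym κ≤q^[M∸1] (ℕ.*-cancelʳ-≤ _ _ q {{ℕ.m^n≢0 2 k}} (begin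
    q ℕ.^ (M ℕ.∸ 1) ℕ.* q    ≡⟨ q^M≡q^[M∸1]*q ⟨
    q ℕ.^ M                  ≤⟨ q^M≤card-R₀ ⟩
    card InR₀?               ≤⟨ card-R₀≤κ*card-GF[q] ⟩
    κ ℕ.* card GF[q]?        ≤⟨ ℕ.*-monoʳ-≤ κ (card-pow-fixed 2≤q) ⟩
    κ ℕ.* q                  ∎))
    where open ℕ.≤-Reasoning

  -- A missed value v would give |R₀| ≤ κ · |GF(q) ∖ {v}| < κ q = q^M.
  T-surjective : ∀ {v} → pow K v q ≈ v → ∃ λ x → InR₀ x × T x ≈ v
  T-surjective {v} v∈GF[q] with Fin.any? (λ i → Tmap.fibre? v (enum i))
  ... | yes (i , x∈R₀ , Tx≈v) = enum i , x∈R₀ , Tx≈v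
  ... | no v∉image = ⊥-elim (ℕ.<⇒≱ card-R₀<q^M q^M≤card-R₀)
    where
    Missed : Pred Carrier 0ℓ
    Missed u = pow K u q ≈ u × ¬ u ≈ v
    Missed? : Decidable Missed
    Missed? u = GF[q]? u ×-dec ¬? (u ≟ v)
    Missed-resp : Missed Respects _≈_
    Missed-resp u≈w (uᵠ≈u , u≉v) = GF[q]-resp u≈w uᵠ≈u , λ w≈v → u≉v (trans u≈w w≈v)
    T-image⊆Missed : ∀ {x} → InR₀ x → Missed (T x)
    T-image⊆Missed {x} x∈R₀ = T-image⊆GF[q] x∈R₀ , λ Tx≈v →
      v∉image (index x , InR₀-resp (sym (enum-index x)) x∈R₀ , trans (T-cong (enum-index x)) Tx≈v)
    card-Missed<q : card Missed? ℕ.< q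
    card-Missed<q = ℕ.≤-trans (count-< (λ i → Missed? (enum i)) (λ i → GF[q]? (enum i)) proj₁
                                        (GF[q]-resp (sym (enum-index v)) v∈GF[q]) (λ m → proj₂ m (enum-index v)))
                              (card-pow-fixed 2≤q)
    card-R₀<q^M : card InR₀? ℕ.< q ℕ.^ M
    card-R₀<q^M = begin-strict
      card InR₀?                     ≤⟨ Tmap.card-domain≤card-kernel*card-image Missed? Missed-resp T-image⊆Missed ⟩
      κ ℕ.* card Missed?             <⟨ ℕ.*-monoʳ-< κ {{κ≢0}} card-Missed<q ⟩
      κ ℕ.* q                        ≡⟨ ≡.trans (≡.cong (ℕ._* q) κ≡q^[M∸1]) (≡.sym q^M≡q^[M∸1]*q) ⟩
      q ℕ.^ M                        ∎
      where
      open ℕ.≤-Reasoning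
      κ≢0 : ℕ.NonZero κ
      κ≢0 = ≡.subst ℕ.NonZero (≡.sym κ≡q^[M∸1]) (ℕ.m^n≢0 q (M ℕ.∸ 1) {{ℕ.m^n≢0 2 k}})

  card-T-fibre : ∀ {v} → pow K v q ≈ v → card (λ x → InR₀? x ×-dec (T x ≟ v)) ≡ q ℕ.^ (M ℕ.∸ 1)
  card-T-fibre v∈GF[q] with T-surjective v∈GF[q]
  ... | x₀ , x₀∈fibre = ≡.trans (ℕ.≤-antisym (Tmap.card-fibre≤card-kernel _) (Tmap.card-kernel≤card-fibre x₀∈fibre)) κ≡q^[M∸1]

  Tr-R₀ : ∀ {γ} → InR₀ γ → Tr K q n γ ≈ 0#
  Tr-R₀ {γ} γ∈R₀ = ≡.subst (λ e → Tr K q e γ ≈ 0#) (≡.sym n≡M+M) (Tr-periodic q M (φ-fixes-R₀ γ∈R₀))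

  St-R₀ : ∀ {γ} → InR₀ γ → St K q n γ ≈ T γ * T γ
  St-R₀ {γ} γ∈R₀ = ≡.subst (λ e → St K q e γ ≈ T γ * T γ) (≡.sym n≡M+M) (St-periodic q M (φ-fixes-R₀ γ∈R₀))

  sqrt : Carrier → Carrier
  sqrt s = pow K s (2 ℕ.^ (k ℕ.∸ 1))

  sqrt-square : ∀ {s} → pow K s q ≈ s → sqrt s * sqrt s ≈ s
  sqrt-square {s} sᵠ≈s = trans (sym (pow-+ s h h)) (≡.subst (λ e → pow K s e ≈ s) (≡.sym h+h≡q) sᵠ≈s)
    where
    h = 2 ℕ.^ (k ℕ.∸ 1)
    h+h≡q : h ℕ.+ h ≡ q
    h+h≡q = ≡.trans (≡.cong (h ℕ.+_) (≡.sym (ℕ.+-identityʳ h))) (≡.cong (2 ℕ.^_) (ℕ.m+[n∸m]≡n 1≤k))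

  sqrt-GF[q] : ∀ {s} → pow K s q ≈ s → pow K (sqrt s) q ≈ sqrt s
  sqrt-GF[q] {s} sᵠ≈s = begin
    pow K (pow K s h) q   ≈⟨ pow-* s h q ⟨
    pow K s (h ℕ.* q)     ≡⟨ ≡.cong (pow K s) (ℕ.*-comm h q) ⟩
    pow K s (q ℕ.* h)     ≈⟨ pow-* s q h ⟩
    pow K (pow K s q) h   ≈⟨ pow-cong h sᵠ≈s ⟩
    pow K s h             ∎
    where
    open import Relation.Binary.Reasoning.Setoid setoid
    h = 2 ℕ.^ (k ℕ.∸ 1)

  St≈s⇔T≈sqrt[s] : ∀ {s γ} → pow K s q ≈ s → InR₀ γ → St K q n γ ≈ s ⇔ T γ ≈ sqrt s
  St≈s⇔T≈sqrt[s] sᵠ≈s γ∈R₀ = mk⇔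
    (λ St≈s → square-injective (trans (sym (St-R₀ γ∈R₀)) (trans St≈s (sym (sqrt-square sᵠ≈s)))))
    (λ T≈√s → trans (St-R₀ γ∈R₀) (trans (*-cong T≈√s T≈√s) (sqrt-square sᵠ≈s)))

open import Data.Nat using (_^_; _*_; _∸_; _≤_)

lemma10 : (k m : ℕ) → 1 ≤ k → 1 ≤ m → (K : FiniteField)
    → FiniteField.size K ≡ (2 ^ k) ^ (4 * m)
    → (t s : FiniteField.Carrier K)
    → FiniteField._≈_ K (pow K t (2 ^ k)) t
    → FiniteField._≈_ K (pow K s (2 ^ k)) s
    → (FiniteField._≈_ K t (FiniteField.0# K)
         → Fcount K (2 ^ k) (4 * m) m t s (FiniteField.0# K) ≡ (2 ^ k) ^ (2 * m ∸ 1))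
      × (¬ FiniteField._≈_ K t (FiniteField.0# K)
         → Fcount K (2 ^ k) (4 * m) m t s (FiniteField.0# K) ≡ 0)
lemma10 k m 1≤k 1≤m K size≡ t s _ sᵠ≈s = Fcount≡q^[2m∸1] , Fcount≡0
  where
  open FiniteField K using (_≈_; 0#; sym; trans; size)
  open RelativeTrace K k (2 * m) (4 * m) 1≤k (ℕ.≤-trans 1≤m (ℕ.m≤m+n m _)) (ℕ.*-distribʳ-+ m 2 2) size≡

  Fcount≡q^[2m∸1] : t ≈ 0# → Fcount K q (4 * m) m t s 0# ≡ q ^ (2 * m ∸ 1)
  Fcount≡q^[2m∸1] t≈0 = ≡.trans (count-cong {N = size} _ _ (to , from)) (card-T-fibre (sqrt-GF[q] sᵠ≈s))
    where
    to : ∀ {γ} → InR₀ γ × Tr K q (4 * m) γ ≈ t × St K q (4 * m) γ ≈ s → InR₀ γ × T γ ≈ sqrt s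
    to (γ∈R₀ , _ , St≈s) = γ∈R₀ , Equivalence.to (St≈s⇔T≈sqrt[s] sᵠ≈s γ∈R₀) St≈s
    from : ∀ {γ} → InR₀ γ × T γ ≈ sqrt s → InR₀ γ × Tr K q (4 * m) γ ≈ t × St K q (4 * m) γ ≈ s
    from (γ∈R₀ , T≈√s) = γ∈R₀ , trans (Tr-R₀ γ∈R₀) (sym t≈0) , Equivalence.from (St≈s⇔T≈sqrt[s] sᵠ≈s γ∈R₀) T≈√s

  Fcount≡0 : ¬ t ≈ 0# → Fcount K q (4 * m) m t s 0# ≡ 0
  Fcount≡0 t≉0 = count-empty {N = size} _ λ _ (γ∈R₀ , Tr≈t , _) → t≉0 (trans (sym Tr≈t) (Tr-R₀ γ∈R₀))
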